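{- Let $T$ be a normal Suslin tree with rational successors, and let $S$ be the lexicographical order of $T$. Suppose $a, b, c$ are nodes of $T$ with $\mathrm{ht}_T(c) < \mathrm{ht}_T(a)$, $\mathrm{ht}_T(c) < \mathrm{ht}_T(b)$, and $a <_S c <_S b$. Then every $d$ with $d \le_T a$ and $d \le_T b$ satisfies $\mathrm{ht}_T(d) < \mathrm{ht}_T(c)$. In particular, $a$ and $b$ are incomparable in $T$.
   Context: A tree is a set $T$ with a strict partial order $<_T$ such that the predecessors of each node are well-ordered; $\mathrm{ht}_T(x)$ is their order type. An $\omega_1$-tree has height $\omega_1$ and countable levels. $T$ is normal if (a) every node $x$ with $\mathrm{ht}_T(x)+1$ less than the height of $T$ has two incomparable nodes above it, (b) every node has nodes comparable to it at every height less than the height of $T$, and (c) distinct nodes of the same limit height have different sets of predecessors. A Suslin tree is an $\omega_1$-tree with no uncountable chain or antichain. $T$ has rational successors if for every node $x$, the set of immediate successors of $x$ (nodes $y >_T x$ with $\mathrm{ht}_T(y)=\mathrm{ht}_T(x)+1$) carries a linear order $<_x$ isomorphic to the rationals. For distinct nodes $a,b$, the lexicographical order $S$ is defined by: if $a <_T b$ then $a <_S b$; if $b <_T a$ then $b <_S a$; if $a,b$ are incomparable, let $x$ be the $<_T$-largest common predecessor of $a$ and $b$ (it exists by normality), and let $y, z$ be the immediate successors of $x$ with $y \le_T a$, $z \le_T b$; then $a <_S b$ iff $y <_x z$. -}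

module Defs where

open import Data.Nat using (ℕ)
open import Data.Product using (Σ; ∃; ∃-syntax; _×_; _,_)
open import Data.Sum using (_⊎_)
open import Data.Empty using (⊥)
open import Data.Unit using (⊤)
open import Relation.Nullary using (¬_)
open import Relation.Binary.PropositionalEquality using (_≡_)
open import Data.Rational as ℚ using (ℚ)

infix 2 _⇔_
_⇔_ : Set → Set → Set
A ⇔ B = (A → B) × (B → A)

IsStrictLinearOn : {A : Set} → (A → Set) → (A → A → Set) → Set
IsStrictLinearOn {A} P R =
  (∀ a → P a → ¬ R a a) ×
  (∀ a b c → P a → P b → P c → R a b → R b c → R a c) ×
  (∀ a b → P a → P b → R a b ⊎ a ≡ b ⊎ R b a)

HasLeast : {A : Set} → (A → Set) → (A → A → Set) → Set₁
HasLeast {A} P R =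
  (Q : A → Set) → (∃[ a ] (P a × Q a)) →
  ∃[ m ] (P m × Q m × (∀ a → P a → Q a → R m a ⊎ m ≡ a))

IsWellOrderOn : {A : Set} → (A → Set) → (A → A → Set) → Set₁
IsWellOrderOn P R = IsStrictLinearOn P R × HasLeast P R

OrderIso : {A B : Set} → (A → Set) → (A → A → Set) →
           (B → Set) → (B → B → Set) → Set
OrderIso {A} {B} P R Q S =
  Σ (A → B) λ f → ((∀ a → P a → Q (f a)) ×
          (∀ a a' → P a → P a' → (R a a' ⇔ S (f a) (f a'))) ×
          (∀ a a' → P a → P a' → f a ≡ f a' → a ≡ a') ×
          (∀ b → Q b → ∃[ a ] (P a × f a ≡ b)))

Countable : {A : Set} → (A → Set) → Set
Countable {A} P = Σ (A → ℕ) λ f → (∀ (a a' : A) → P a → P a' → f a ≡ f a' → a ≡ a')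

record Tree : Set₂ where
  field
    Node    : Set
    _<T_    : Node → Node → Set
    irrefl  : ∀ x → ¬ (x <T x)
    trans   : ∀ x y z → x <T y → y <T z → x <T z
    predWO  : ∀ x → IsWellOrderOn (λ y → y <T x) _<T_

module TreeNotions (𝒯 : Tree) where
  open Tree 𝒯

  _≤T_ : Node → Node → Set
  x ≤T y = x <T y ⊎ x ≡ y

  Incomparable : Node → Node → Set
  Incomparable x y = ¬ (x ≤T y) × ¬ (y ≤T x)

  Pred : Node → Node → Set
  Pred x y = y <T x

  HtEq : Node → Node → Set
  HtEq x y = OrderIso (Pred x) _<T_ (Pred y) _<T_

  -- ht(x) < ht(y) : pred(x) is isomorphic to a proper initial segment
  -- of pred(y); such segments are exactly pred(z) for z <T y
  HtLt : Node → Node → Set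
  HtLt x y = ∃[ z ] (z <T y × HtEq x z)

  -- y is an immediate successor of x : x <T y and ht(y) = ht(x)+1,
  -- i.e. x is the maximum of pred(y)
  ImmSucc : Node → Node → Set
  ImmSucc x y = x <T y × (∀ w → w <T y → w ≤T x)

  -- ht(x) is a limit ordinal (nonzero, no maximal predecessor)
  LimitHt : Node → Set
  LimitHt x = (∃[ y ] (y <T x)) × (∀ y → y <T x → ∃[ z ] (y <T z × z <T x))

  -- ω₁-tree: every height is a countable ordinal, every countably infinite
  -- ordinal (well-order on ℕ) is a height, and levels are countable
  IsOmega1Tree : Set₁
  IsOmega1Tree =
    (∀ x → Countable (Pred x)) ×
    (∀ (R : ℕ → ℕ → Set) → IsWellOrderOn (λ _ → ⊤) R →
       ∃[ x ] OrderIso (λ _ → ⊤) R (Pred x) _<T_) ×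
    (∀ x → Countable (λ y → HtEq y x))

  -- normality, for a tree of height ω₁ (so ht(x)+1 < ht(T) always holds,
  -- and heights < ht(T) are exactly the heights of nodes w)
  IsNormal : Set
  IsNormal =
    (∀ x → ∃[ y ] ∃[ z ] (x <T y × x <T z × Incomparable y z)) ×
    (∀ x w → ∃[ y ] (HtEq y w × (y ≤T x ⊎ x <T y))) ×
    (∀ x y → HtEq x y → LimitHt x → (∀ w → (w <T x ⇔ w <T y)) → x ≡ y)

  IsChain : (Node → Set) → Set
  IsChain C = ∀ x y → C x → C y → x ≤T y ⊎ y ≤T x

  IsAntichain : (Node → Set) → Set
  IsAntichain C = ∀ x y → C x → C y → x ≡ y ⊎ Incomparable x y

  IsSuslin : Set₁
  IsSuslin =
    IsOmega1Tree ×
    ¬ (Σ (Node → Set) λ C → IsChain C × ¬ Countable C) ×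
    ¬ (Σ (Node → Set) λ C → IsAntichain C × ¬ Countable C)

  record RationalSuccessors : Set₁ where
    field
      succOrd : Node → Node → Node → Set   -- succOrd x y z  means  y <ₓ z
      succIso : ∀ x → OrderIso (ImmSucc x) (succOrd x) (λ _ → ⊤) ℚ._<_

  module Lex (RS : RationalSuccessors) where
    open RationalSuccessors RS

    LargestCommonPred : Node → Node → Node → Set
    LargestCommonPred a b x =
      (x <T a × x <T b) × (∀ w → w <T a → w <T b → w ≤T x)

    _<S_ : Node → Node → Set
    a <S b =
      a <T b ⊎
      (Incomparable a b ×
        ∃[ x ] ∃[ y ] ∃[ z ]
          (LargestCommonPred a b x × ImmSucc x y × ImmSucc x z ×
           y ≤T a × z ≤T b × succOrd x y z))

-- A common lower bound d of a and b is compared, in the chains below b and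
-- below a, with the branching point x of a and c and the branching point x' of
-- c and b; this puts d below c unless x = x'. Then a, c and b leave x through
-- immediate successors y <ₓ z <ₓ z', so y ≠ z' and d cannot pass x. Since
-- ht(c) < ht(a) and ht(c) < ht(b), neither a nor b lies below c (a well-order is
-- never isomorphic to a proper initial segment of itself), so neither can be a
-- common lower bound: a and b are incomparable.
module Submission where

open import Defs
open import Data.Product using (_×_; _,_; proj₁; proj₂)
open import Data.Sum using (_⊎_; inj₁; inj₂)
open import Data.Empty using (⊥-elim)
open import Relation.Nullary using (¬_)
open import Relation.Binary.PropositionalEquality using (_≡_; _≢_; refl; sym; subst)
import Data.Rational.Properties as ℚ

module TreeLemmas (𝒯 : Tree) where
  open Tree 𝒯
  open TreeNotions 𝒯

  ≤-<-trans : ∀ {u v w} → u ≤T v → v <T w → u <T w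
  ≤-<-trans {u} {v} {w} (inj₁ u<v) v<w = trans u v w u<v v<w
  ≤-<-trans (inj₂ refl) v<w = v<w

  <-≤-trans : ∀ {u v w} → u <T v → v ≤T w → u <T w
  <-≤-trans {u} {v} {w} u<v (inj₁ v<w) = trans u v w u<v v<w
  <-≤-trans u<v (inj₂ refl) = u<v

  ≤T-trans : ∀ {u v w} → u ≤T v → v ≤T w → u ≤T w
  ≤T-trans (inj₁ u<v) v≤w = inj₁ (<-≤-trans u<v v≤w)
  ≤T-trans (inj₂ refl) v≤w = v≤w

  ≤T-connex-below : ∀ a {u v} → u ≤T a → v ≤T a → u ≤T v ⊎ v <T u
  ≤T-connex-below a (inj₁ u<a) (inj₁ v<a) with proj₂ (proj₂ (proj₁ (predWO a))) _ _ u<a v<a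
  ... | inj₁ u<v        = inj₁ (inj₁ u<v)
  ... | inj₂ (inj₁ u≡v) = inj₁ (inj₂ u≡v)
  ... | inj₂ (inj₂ v<u) = inj₂ v<u
  ≤T-connex-below a (inj₁ u<a) (inj₂ refl) = inj₁ (inj₁ u<a)
  ≤T-connex-below a (inj₂ refl) (inj₁ v<a) = inj₂ v<a
  ≤T-connex-below a (inj₂ refl) (inj₂ refl) = inj₁ (inj₂ refl)

  HtEq-refl : ∀ x → HtEq x x
  HtEq-refl x = (λ w → w) , (λ _ w<x → w<x) , (λ _ _ _ _ → (λ p → p) , (λ p → p)) ,
                (λ _ _ _ _ e → e) , (λ w w<x → w , w<x , refl)

  <T⇒HtLt : ∀ {d c} → d <T c → HtLt d c
  <T⇒HtLt {d} d<c = d , d<c , HtEq-refl d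

  -- The least w <T c with f w <T w would have f (f w) <T f w, contradicting minimality.
  ¬HtEq-pred : ∀ {c z} → z <T c → ¬ HtEq c z
  ¬HtEq-pred {c} {z} z<c (f , f-into , f-mono , _ , _)
    with proj₂ (predWO c) (λ w → f w <T w) (z , z<c , f-into z z<c)
  ... | m , m<c , fm<m , m-least
    with m-least (f m) fm<c (proj₁ (f-mono (f m) m fm<c m<c) fm<m)
    where fm<c = trans (f m) m c fm<m m<c
  ... | inj₁ m<fm = irrefl m (trans m (f m) m m<fm fm<m)
  ... | inj₂ m≡fm = irrefl m (subst (_<T m) (sym m≡fm) fm<m)

  HtLt⇒¬<T : ∀ {c a} → HtLt c a → ¬ a <T c
  HtLt⇒¬<T {c} {a} (z , z<a , c≅z) a<c = ¬HtEq-pred (trans z a c z<a a<c) c≅z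

  ImmSucc-unique : ∀ {x y z w} → ImmSucc x y → ImmSucc x z → y ≤T w → z ≤T w → y ≡ z
  ImmSucc-unique {x} (x<y , y-max) (x<z , z-max) y≤w z≤w with ≤T-connex-below _ y≤w z≤w
  ... | inj₁ (inj₂ y≡z) = y≡z
  ... | inj₁ (inj₁ y<z) = ⊥-elim (irrefl x (<-≤-trans x<y (z-max _ y<z)))
  ... | inj₂ z<y        = ⊥-elim (irrefl x (<-≤-trans x<z (y-max _ z<y)))

  lowerBound-≤-branchPoint : ∀ {x y z a b d} → ImmSucc x y → ImmSucc x z → y ≢ z →
    y ≤T a → z ≤T b → d ≤T a → d ≤T b → d ≤T x
  lowerBound-≤-branchPoint {a = a} y-succ z-succ y≢z y≤a z≤b d≤a d≤b
    with ≤T-connex-below a y≤a d≤a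
  ... | inj₁ y≤d = ⊥-elim (y≢z (ImmSucc-unique y-succ z-succ (≤T-trans y≤d d≤b) z≤b))
  ... | inj₂ d<y = proj₂ y-succ _ d<y

  module LexLemmas (RS : RationalSuccessors) where
    open RationalSuccessors RS
    open Lex RS

    succOrd-asym : ∀ {x y z} → ImmSucc x y → ImmSucc x z → succOrd x y z → ¬ succOrd x z y
    succOrd-asym {x} {y} {z} y-succ z-succ y<z z<y with succIso x
    ... | _ , _ , f-mono , _ , _ =
      ℚ.<-irrefl refl (ℚ.<-trans (proj₁ (f-mono y z y-succ z-succ) y<z)
                                 (proj₁ (f-mono z y z-succ y-succ) z<y))

    LargestCommonPred-sym : ∀ {a b x} → LargestCommonPred a b x → LargestCommonPred b a x
    LargestCommonPred-sym ((x<a , x<b) , x-max) = (x<b , x<a) , λ w w<b w<a → x-max w w<a w<b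

    lowerBound-≤-or-≤LargestCommonPred : ∀ {p c r x u d} → LargestCommonPred p c x →
      u <T c → u ≤T r → d ≤T p → d ≤T r → d ≤T u ⊎ u ≤T x
    lowerBound-≤-or-≤LargestCommonPred {r = r} (_ , x-max) u<c u≤r d≤p d≤r
      with ≤T-connex-below r d≤r u≤r
    ... | inj₁ d≤u = inj₁ d≤u
    ... | inj₂ u<d = inj₂ (x-max _ (<-≤-trans u<d d≤p) u<c)

    lowerBound-<T-of-≰-<T : ∀ {a b c d} → ¬ c ≤T a → c <T b → d ≤T a → d ≤T b → d <T c
    lowerBound-<T-of-≰-<T c≰a c<b d≤a d≤b with ≤T-connex-below _ (inj₁ c<b) d≤b
    ... | inj₁ c≤d = ⊥-elim (c≰a (≤T-trans c≤d d≤a))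
    ... | inj₂ d<c = d<c

    lowerBound-<T-of-<S-<S : ∀ {a b c d} → a <S c → ¬ a <T c → c <S b →
      d ≤T a → d ≤T b → d <T c
    lowerBound-<T-of-<S-<S (inj₁ a<c) a≮c _ _ _ = ⊥-elim (a≮c a<c)
    lowerBound-<T-of-<S-<S (inj₂ ((_ , c≰a) , _)) _ (inj₁ c<b) = lowerBound-<T-of-≰-<T c≰a c<b
    lowerBound-<T-of-<S-<S {d = d}
      (inj₂ (_ , x , y , z , lcp@((x<a , x<c) , _) , y-succ , z-succ , y≤a , z≤c , y<z))
      _
      (inj₂ (_ , x' , y' , z' , lcp'@((x'<c , x'<b) , _) , y'-succ , z'-succ , y'≤c , z'≤b , y'<z'))
      d≤a d≤b
      with lowerBound-≤-or-≤LargestCommonPred lcp x'<c (inj₁ x'<b) d≤a d≤b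
         | lowerBound-≤-or-≤LargestCommonPred (LargestCommonPred-sym lcp') x<c (inj₁ x<a) d≤b d≤a
    ... | inj₁ d≤x' | _ = ≤-<-trans d≤x' x'<c
    ... | _ | inj₁ d≤x = ≤-<-trans d≤x x<c
    ... | inj₂ (inj₁ x'<x) | inj₂ x≤x' = ⊥-elim (irrefl x' (<-≤-trans x'<x x≤x'))
    ... | inj₂ (inj₂ refl) | inj₂ _ = ≤-<-trans d≤x x<c
      where
      z≡y' : z ≡ y'
      z≡y' = ImmSucc-unique z-succ y'-succ z≤c y'≤c

      y≢z' : y ≢ z'
      y≢z' refl = succOrd-asym y-succ z-succ y<z (subst (λ w → succOrd x w y) (sym z≡y') y'<z')

      d≤x : d ≤T x
      d≤x = lowerBound-≤-branchPoint y-succ z'-succ y≢z' y≤a z'≤b d≤a d≤b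

lemma2p4 : (𝒯 : Tree) → let open TreeNotions 𝒯 in
    IsNormal → IsSuslin → (RS : RationalSuccessors) →
    let open Lex RS in
    ∀ a b c → HtLt c a → HtLt c b → a <S c → c <S b →
    (∀ d → d ≤T a → d ≤T b → HtLt d c) × Incomparable a b
lemma2p4 𝒯 _ _ RS a b c c<ᴴa c<ᴴb a<Sc c<Sb =
  (λ d d≤a d≤b → <T⇒HtLt (lowerBound-<T d≤a d≤b)) ,
  (λ a≤b → HtLt⇒¬<T c<ᴴa (lowerBound-<T (inj₂ refl) a≤b)) ,
  (λ b≤a → HtLt⇒¬<T c<ᴴb (lowerBound-<T b≤a (inj₂ refl)))
  where
  open Tree 𝒯
  open TreeNotions 𝒯
  open TreeLemmas 𝒯
  open LexLemmas RS

  lowerBound-<T : ∀ {d} → d ≤T a → d ≤T b → d <T c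
  lowerBound-<T = lowerBound-<T-of-<S-<S a<Sc (HtLt⇒¬<T c<ᴴa) c<Sb
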